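{- Every weighted game with exactly two types of voters in which one of the two classes consists of null voters has a unique minimum integer representation.
   Context: A simple game on $N$ is a monotone $\chi:2^N\to\{0,1\}$ with $\chi(\emptyset)=0$, $\chi(N)=1$; it is weighted if there are non-negative weights and a quota $q$ with $U$ winning iff its weight is $\ge q$. Types are the equivalence classes of Isbell's desirability relation ($i$ at least as desirable as $j$ iff replacing $j$ by $i$ never turns a winning coalition losing). A voter $i$ is a null voter if $\chi(U)=\chi(U\cup\{i\})$ for all $U$. An integer representation $[q;w_1,\dots,w_n]$ has non-negative integer weights and integer quota with winning coalitions of weight $\ge q$ and losing ones of weight $\le q-1$; it is a minimum integer representation if $w_i\le w_i'$ for all $i$ for every integer representation $[q';w']$ of the same game.
   Formalization: The weights and the quota $q$ that make the game weighted are rational. -}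

module Defs where

open import Data.Nat using (ℕ; zero; suc) renaming (_+_ to _+ℕ_; _≤_ to _≤ℕ_)
open import Data.Integer using (ℤ; +_; _-_) renaming (_≤_ to _≤ℤ_)
open import Data.Rational using (ℚ; 0ℚ) renaming (_+_ to _+ℚ_; _≤_ to _≤ℚ_)
open import Data.Bool using (Bool; true; false; if_then_else_)
open import Data.Fin using (Fin; zero; suc)
open import Data.Fin.Subset using (Subset; ⊥; ⊤; ⁅_⁆; _∈_; _∉_; _⊆_; _∪_)
open import Data.Vec using ([]; _∷_)
open import Data.Product using (Σ; _×_; ∃; ∃-syntax; _,_)
open import Data.Sum using (_⊎_)
open import Function using (_∘_; _⇔_)
open import Relation.Nullary using (¬_)
open import Relation.Binary.PropositionalEquality using (_≡_)

record SimpleGame (n : ℕ) : Set where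
  field
    χ        : Subset n → Bool
    monotone : ∀ (U V : Subset n) → U ⊆ V → χ U ≡ true → χ V ≡ true
    empty    : χ ⊥ ≡ false
    grand    : χ ⊤ ≡ true
open SimpleGame public

weightℕ : ∀ {n} → (Fin n → ℕ) → Subset n → ℕ
weightℕ {zero}  w []      = 0
weightℕ {suc n} w (b ∷ U) = (if b then w zero else 0) +ℕ weightℕ (w ∘ suc) U

weightℚ : ∀ {n} → (Fin n → ℚ) → Subset n → ℚ
weightℚ {zero}  w []      = 0ℚ
weightℚ {suc n} w (b ∷ U) = (if b then w zero else 0ℚ) +ℚ weightℚ (w ∘ suc) U

IsWeighted : ∀ {n} → SimpleGame n → Set
IsWeighted {n} G =
  Σ (Fin n → ℚ) λ w → Σ ℚ λ q →
    (∀ i → 0ℚ ≤ℚ w i) × (∀ U → (χ G U ≡ true) ⇔ (q ≤ℚ weightℚ w U))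

_≽[_]_ : ∀ {n} → Fin n → SimpleGame n → Fin n → Set
i ≽[ G ] j = ∀ U → i ∉ U → j ∉ U → χ G (U ∪ ⁅ j ⁆) ≡ true → χ G (U ∪ ⁅ i ⁆) ≡ true

_∼[_]_ : ∀ {n} → Fin n → SimpleGame n → Fin n → Set
i ∼[ G ] j = (i ≽[ G ] j) × (j ≽[ G ] i)

IsNull : ∀ {n} → SimpleGame n → Fin n → Set
IsNull G i = ∀ U → χ G U ≡ χ G (U ∪ ⁅ i ⁆)

TwoTypesOneNull : ∀ {n} → SimpleGame n → Set
TwoTypesOneNull {n} G =
  Σ (Fin n) λ a → Σ (Fin n) λ b →
    ¬ (a ∼[ G ] b) ×
    (∀ c → (c ∼[ G ] a) ⊎ (c ∼[ G ] b)) ×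
    (∀ c → c ∼[ G ] b → IsNull G c)

IsIntRep : ∀ {n} → SimpleGame n → ℤ → (Fin n → ℕ) → Set
IsIntRep G q w =
  (∀ U → χ G U ≡ true  → q ≤ℤ + weightℕ w U) ×
  (∀ U → χ G U ≡ false → + weightℕ w U ≤ℤ q - + 1)

IsMinIntRep : ∀ {n} → SimpleGame n → ℤ → (Fin n → ℕ) → Set
IsMinIntRep G q w =
  IsIntRep G q w ×
  (∀ q' w' → IsIntRep G q' w' → ∀ i → w i ≤ℕ w' i)

-- A voter is pivotal if adding it to some coalition turns that coalition from
-- losing into winning; the other voters are exactly the null voters. All
-- pivotal voters lie in one type and desirability is transitive, so any
-- pivotal voter can replace any other in a coalition without making it lose.
-- Dropping null voters and exchanging pivotal ones then shows that winning
-- depends only, and monotonically, on the number of pivotal members; with k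
-- the least such number of a winning coalition, [k; 1 on pivotal voters, 0 on
-- null voters] represents the game. Any integer representation gives a pivotal
-- voter weight at least 1, since adding it turns a losing coalition winning,
-- so these weights are the minimum ones; and the quota of a representation
-- with these weights is forced to be k by a winning coalition with k pivotal
-- members that loses once one of them is removed.
module Submission where

open import Defs
open import Data.Bool using (true; false)
open import Data.Bool.Properties using (¬-not) renaming (_≟_ to _≟ᵇ_)
open import Data.Fin using (Fin; zero; suc; _≟_)
open import Data.Fin.Properties using (any?)
open import Data.Fin.Subset
  using (Subset; outside; inside; ⊥; ⁅_⁆; _∪_; _─_; _-_; _∈_; _∉_; _⊆_; ∣_∣)
open import Data.Fin.Subset.Properties
  using ( _∈?_; anySubset?; drop-there; x∈⁅x⁆; x∈⁅y⁆⇒x≡y; x∉⁅y⁆⇒x≢y; ⊆-antisym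
        ; p⊆p∪q; q⊆p∪q; x∈p∪q⁻; ∪-assoc; ∪-comm; ∪-identityʳ; p─q⊆p
        ; x∈p∧x∉q⇒x∈p─q; x∈p∧x≢y⇒x∈p-y; x∈p⇒∣p-x∣<∣p∣; p⊆q⇒∣p∣≤∣q∣ )
open import Data.Integer using (ℤ; +_; -1ℤ; +≤+; +<+; pred)
  renaming (_-_ to _-ℤ_; suc to sucℤ; _≤_ to _≤ℤ_; _<_ to _<ℤ_)
import Data.Integer.Properties as ℤ
open import Data.Nat using (ℕ; zero; suc; _+_; _≤_; _<_; _≤?_; z≤n; s≤s⁻¹)
open import Data.Nat.Properties
  using (≤-refl; ≤-trans; ≤-reflexive; ≤-antisym; <-≤-trans; ≤-<-trans; <⇒≱; ≰⇒>
        ; +-monoʳ-≤; m≤n+m; +-cancelʳ-<; +-commutativeSemigroup)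
open import Algebra.Properties.CommutativeSemigroup +-commutativeSemigroup using (x∙yz≈y∙xz)
open import Data.Product using (Σ; ∃; _×_; _,_; proj₁; proj₂)
open import Data.Sum using (_⊎_; inj₁; inj₂)
open import Data.Vec using ([]; _∷_; here; there)
open import Function using (_∘_)
open import Relation.Binary.PropositionalEquality
open import Relation.Nullary using (¬_; yes; no; contradiction; ¬?)
open import Relation.Nullary.Decidable using (_×-dec_)
open import Relation.Unary using (Pred; Decidable)

private
  variable
    n : ℕ
    p q U V : Subset n
    x y : Fin n

x∈p─q⇒x∉q : x ∈ p ─ q → x ∉ q
x∈p─q⇒x∉q {p = _ ∷ _} {q = outside ∷ q} here        = λ ()
x∈p─q⇒x∉q {p = _ ∷ _} {q = outside ∷ q} (there x∈) = x∈p─q⇒x∉q x∈ ∘ drop-there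
x∈p─q⇒x∉q {p = _ ∷ _} {q = inside  ∷ q} (there x∈) = x∈p─q⇒x∉q x∈ ∘ drop-there

x∉p-x : ∀ {p : Subset n} → x ∉ p - x
x∉p-x {x = x} x∈ = x∈p─q⇒x∉q x∈ (x∈⁅x⁆ x)

∉-∪⁅⁆ : x ∉ p → x ≢ y → x ∉ p ∪ ⁅ y ⁆
∉-∪⁅⁆ {p = p} {y = y} x∉p x≢y x∈ with x∈p∪q⁻ p ⁅ y ⁆ x∈
... | inj₁ x∈p = x∉p x∈p
... | inj₂ x∈y = x≢y (x∈⁅y⁆⇒x≡y y x∈y)

∪⁅⁆-absorb : x ∈ p → p ∪ ⁅ x ⁆ ≡ p
∪⁅⁆-absorb {x = x} {p = p} x∈p = ⊆-antisym sub (p⊆p∪q ⁅ x ⁆)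
  where
  sub : p ∪ ⁅ x ⁆ ⊆ p
  sub y∈ with x∈p∪q⁻ p ⁅ x ⁆ y∈
  ... | inj₁ y∈p = y∈p
  ... | inj₂ y∈x rewrite x∈⁅y⁆⇒x≡y x y∈x = x∈p

-∪⁅⁆-cancel : x ∈ p → (p - x) ∪ ⁅ x ⁆ ≡ p
-∪⁅⁆-cancel {x = x} {p = p} x∈p = ⊆-antisym sub sup
  where
  sub : (p - x) ∪ ⁅ x ⁆ ⊆ p
  sub y∈ with x∈p∪q⁻ (p - x) ⁅ x ⁆ y∈
  ... | inj₁ y∈p-x = p─q⊆p p ⁅ x ⁆ y∈p-x
  ... | inj₂ y∈x rewrite x∈⁅y⁆⇒x≡y x y∈x = x∈p
  sup : p ⊆ (p - x) ∪ ⁅ x ⁆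
  sup {y} y∈p with y ≟ x
  ... | yes refl = q⊆p∪q (p - x) ⁅ x ⁆ (x∈⁅x⁆ x)
  ... | no y≢x   = p⊆p∪q ⁅ x ⁆ (x∈p∧x≢y⇒x∈p-y y∈p y≢x)

∪-swap : ∀ (p q r : Subset n) → (p ∪ q) ∪ r ≡ (p ∪ r) ∪ q
∪-swap p q r = begin
  (p ∪ q) ∪ r  ≡⟨ ∪-assoc p q r ⟩
  p ∪ (q ∪ r)  ≡⟨ cong (p ∪_) (∪-comm q r) ⟩
  p ∪ (r ∪ q)  ≡⟨ ∪-assoc p r q ⟨
  (p ∪ r) ∪ q  ∎
  where open ≡-Reasoning

∣─∣-decreasing : ∀ {U′ : Subset n} → U′ ⊆ (U - x) ∪ V → x ∈ U → x ∉ V →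
                 ∣ U′ ─ V ∣ < ∣ U ─ V ∣
∣─∣-decreasing {U = U} {x = x} {V = V} {U′} U′⊆ x∈U x∉V =
  ≤-<-trans (p⊆q⇒∣p∣≤∣q∣ sub) (x∈p⇒∣p-x∣<∣p∣ (x∈p∧x∉q⇒x∈p─q x∈U x∉V))
  where
  sub : U′ ─ V ⊆ (U ─ V) - x
  sub {z} z∈ with x∈p∪q⁻ (U - x) V (U′⊆ (p─q⊆p U′ V z∈))
  ... | inj₂ z∈V   = contradiction z∈V (x∈p─q⇒x∉q z∈)
  ... | inj₁ z∈U-x = x∈p∧x≢y⇒x∈p-y
    (x∈p∧x∉q⇒x∈p─q (p─q⊆p U ⁅ x ⁆ z∈U-x) (x∈p─q⇒x∉q z∈))
    (x∉⁅y⁆⇒x≢y (x∈p─q⇒x∉q z∈U-x))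

argmin-subset : ∀ {ℓ} {P : Pred (Subset n) ℓ} → Decidable P → (f : Subset n → ℕ) →
                P U → ∃ λ M → P M × (∀ {V} → P V → f M ≤ f V)
argmin-subset {U = U} {P = P} P? f PU = go (f U) (U , PU , ≤-refl)
  where
  go : ∀ k → (∃ λ U → P U × f U ≤ k) → ∃ λ M → P M × (∀ {V} → P V → f M ≤ f V)
  go zero    (U , PU , fU≤0) = U , PU , λ _ → ≤-trans fU≤0 z≤n
  go (suc k) (U , PU , fU≤1+k) with anySubset? (λ V → P? V ×-dec f V ≤? k)
  ... | yes below = go k below
  ... | no ¬below = U , PU , λ {V} PV →
    ≤-trans fU≤1+k (≰⇒> (λ fV≤k → ¬below (V , PV , fV≤k)))

weight-cong : ∀ {w w′ : Fin n → ℕ} → (∀ i → w i ≡ w′ i) → ∀ p → weightℕ w p ≡ weightℕ w′ p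
weight-cong w≗w′ []            = refl
weight-cong w≗w′ (outside ∷ p) = weight-cong (w≗w′ ∘ suc) p
weight-cong w≗w′ (inside ∷ p)  = cong₂ _+_ (w≗w′ zero) (weight-cong (w≗w′ ∘ suc) p)

weight-∪⁅⁆ : ∀ (w : Fin n → ℕ) → x ∉ p → weightℕ w (p ∪ ⁅ x ⁆) ≡ w x + weightℕ w p
weight-∪⁅⁆ {x = zero} {p = outside ∷ p} w _ =
  cong (λ r → w zero + weightℕ (w ∘ suc) r) (∪-identityʳ p)
weight-∪⁅⁆ {x = zero} {p = inside ∷ p} w x∉p = contradiction here x∉p
weight-∪⁅⁆ {x = suc x} {p = outside ∷ p} w x∉p = weight-∪⁅⁆ (w ∘ suc) (x∉p ∘ there)
weight-∪⁅⁆ {x = suc x} {p = inside ∷ p} w x∉p = begin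
  w zero + weightℕ (w ∘ suc) (p ∪ ⁅ x ⁆)
    ≡⟨ cong (_+_ (w zero)) (weight-∪⁅⁆ (w ∘ suc) (x∉p ∘ there)) ⟩
  w zero + (w (suc x) + weightℕ (w ∘ suc) p)  ≡⟨ x∙yz≈y∙xz (w zero) (w (suc x)) _ ⟩
  w (suc x) + (w zero + weightℕ (w ∘ suc) p)  ∎
  where open ≡-Reasoning

weight-remove : ∀ (w : Fin n → ℕ) → x ∈ p → w x + weightℕ w (p - x) ≡ weightℕ w p
weight-remove {x = x} {p = p} w x∈p = begin
  w x + weightℕ w (p - x)      ≡⟨ weight-∪⁅⁆ w x∉p-x ⟨
  weightℕ w ((p - x) ∪ ⁅ x ⁆)  ≡⟨ cong (weightℕ w) (-∪⁅⁆-cancel x∈p) ⟩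
  weightℕ w p                  ∎
  where open ≡-Reasoning

weight-≤ : ∀ (w : Fin n → ℕ) → (∀ {y} → y ∈ p → y ∉ q → w y ≡ 0) → weightℕ w p ≤ weightℕ w q
weight-≤ {p = []} {q = []} w _ = z≤n
weight-≤ {p = s ∷ p} {q = t ∷ q} w h
  with weight-≤ {p = p} {q = q} (w ∘ suc) (λ y∈p y∉q → h (there y∈p) (y∉q ∘ drop-there))
... | tail≤ with s | t
... | outside | _       = ≤-trans tail≤ (m≤n+m _ _)
... | inside  | inside  = +-monoʳ-≤ (w zero) tail≤
... | inside  | outside = ≤-trans (≤-reflexive (cong (_+ weightℕ (w ∘ suc) p) (h here λ ()))) tail≤

i-1≡pred[i] : ∀ (i : ℤ) → i -ℤ + 1 ≡ pred i
i-1≡pred[i] i = ℤ.+-comm i -1ℤ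

module _ (G : SimpleGame n) where

  IsIntRep-threshold : ∀ {k : ℕ} {w : Fin n → ℕ} →
                       (∀ U → χ G U ≡ true → k ≤ weightℕ w U) →
                       (∀ U → χ G U ≡ false → weightℕ w U < k) →
                       IsIntRep G (+ k) w
  IsIntRep-threshold {k = k} win lose =
    (λ U → +≤+ ∘ win U) ,
    (λ U → subst (_ ≤ℤ_) (sym (i-1≡pred[i] (+ k))) ∘ ℤ.i<j⇒i≤pred[j] ∘ +<+ ∘ lose U)

  IsIntRep-cong : ∀ {q : ℤ} {w w′ : Fin n → ℕ} →
                  (∀ i → w i ≡ w′ i) → IsIntRep G q w → IsIntRep G q w′
  IsIntRep-cong w≗w′ (win , lose) =
    (λ U → subst (λ m → _ ≤ℤ + m) (weight-cong w≗w′ U) ∘ win U) ,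
    (λ U → subst (λ m → + m ≤ℤ _) (weight-cong w≗w′ U) ∘ lose U)

  losing-<ℤ-quota : ∀ {q : ℤ} {w : Fin n → ℕ} → IsIntRep G q w →
                    χ G V ≡ false → + weightℕ w V <ℤ q
  losing-<ℤ-quota {V = V} {q = q} (_ , lose) V-loses =
    ℤ.i≤pred[j]⇒i<j (subst (_ ≤ℤ_) (i-1≡pred[i] q) (lose V V-loses))

  losing<winning : ∀ {q : ℤ} {w : Fin n → ℕ} → IsIntRep G q w →
                   χ G U ≡ true → χ G V ≡ false → weightℕ w V < weightℕ w U
  losing<winning {U = U} {V = V} rep@(win , _) U-wins V-loses =
    ℤ.drop‿+<+ (ℤ.<-≤-trans (losing-<ℤ-quota {V = V} rep V-loses) (win U U-wins))

  quota-pinned : ∀ {q : ℤ} {w : Fin n → ℕ} → IsIntRep G q w →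
                 χ G U ≡ true → χ G V ≡ false → weightℕ w U ≡ suc (weightℕ w V) →
                 q ≡ + weightℕ w U
  quota-pinned {U = U} {V = V} {q = q} {w = w} rep@(win , _) U-wins V-loses U=V+1 =
    ℤ.≤-antisym (win U U-wins) (begin
      + weightℕ w U               ≡⟨ cong +_ U=V+1 ⟩
      sucℤ (+ weightℕ w V)        ≤⟨ ℤ.suc-mono (ℤ.i<j⇒i≤pred[j] (losing-<ℤ-quota {V = V} rep V-loses)) ⟩
      sucℤ (pred q)               ≡⟨ ℤ.suc-pred q ⟩
      q                           ∎)
    where open ℤ.≤-Reasoning

  ≽-trans : ∀ {i j k : Fin n} → i ≽[ G ] j → j ≽[ G ] k → i ≽[ G ] k
  ≽-trans {i} {j} {k} i≽j j≽k U i∉U k∉U U+k-wins with j ∈? U | i ≟ k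
  ... | no j∉U  | _        = i≽j U i∉U j∉U (j≽k U j∉U k∉U U+k-wins)
  ... | yes j∈U | yes refl = U+k-wins
  ... | yes j∈U | no i≢k   = subst Wins (U′+j≡U ⁅ i ⁆) U′+i+j-wins
    where
    -- Inside U ∪ ⁅ k ⁆, first replace j by i, then k by j.
    Wins : Subset _ → Set
    Wins S = χ G S ≡ true
    U′ = U - j
    i∉U′ : i ∉ U′
    i∉U′ = i∉U ∘ p─q⊆p U ⁅ j ⁆
    j≢i : j ≢ i
    j≢i refl = i∉U j∈U
    j≢k : j ≢ k
    j≢k refl = k∉U j∈U
    U′+j≡U : ∀ r → (U′ ∪ r) ∪ ⁅ j ⁆ ≡ U ∪ r
    U′+j≡U r = trans (∪-swap U′ r ⁅ j ⁆) (cong (_∪ r) (-∪⁅⁆-cancel j∈U))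
    U′+k+i-wins : Wins ((U′ ∪ ⁅ k ⁆) ∪ ⁅ i ⁆)
    U′+k+i-wins = i≽j (U′ ∪ ⁅ k ⁆) (∉-∪⁅⁆ i∉U′ i≢k) (∉-∪⁅⁆ x∉p-x j≢k)
                      (subst Wins (sym (U′+j≡U ⁅ k ⁆)) U+k-wins)
    U′+i+j-wins : Wins ((U′ ∪ ⁅ i ⁆) ∪ ⁅ j ⁆)
    U′+i+j-wins = j≽k (U′ ∪ ⁅ i ⁆) (∉-∪⁅⁆ x∉p-x j≢i) (∉-∪⁅⁆ (k∉U ∘ p─q⊆p U ⁅ j ⁆) (i≢k ∘ sym))
                      (subst Wins (∪-swap U′ ⁅ k ⁆ ⁅ i ⁆) U′+k+i-wins)

  Swing : Fin n → Subset n → Set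
  Swing x U = x ∉ U × χ G U ≡ false × χ G (U ∪ ⁅ x ⁆) ≡ true

  IsPivotal : Fin n → Set
  IsPivotal x = ∃ (Swing x)

  pivotal? : Decidable IsPivotal
  pivotal? x = anySubset? (λ U → ¬? (x ∈? U) ×-dec (χ G U ≟ᵇ false ×-dec χ G (U ∪ ⁅ x ⁆) ≟ᵇ true))

  ¬pivotal⇒null : ¬ IsPivotal x → IsNull G x
  ¬pivotal⇒null {x = x} ¬pivotal U with x ∈? U
  ... | yes x∈U = cong (χ G) (sym (∪⁅⁆-absorb x∈U))
  ... | no x∉U with χ G U in U-val | χ G (U ∪ ⁅ x ⁆) in U+x-val
  ... | true  | true  = refl
  ... | false | false = refl
  ... | true  | false = contradiction (trans (sym U+x-val) (monotone G U _ (p⊆p∪q ⁅ x ⁆) U-val)) λ ()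
  ... | false | true  = contradiction (U , x∉U , U-val , U+x-val) ¬pivotal

  null⇒¬pivotal : IsNull G x → ¬ IsPivotal x
  null⇒¬pivotal null (U , _ , U-loses , U+x-wins) =
    contradiction (trans (sym U+x-wins) (trans (sym (null U)) U-loses)) λ ()

  pivotal-weight-positive : ∀ {q : ℤ} {w : Fin n → ℕ} → IsIntRep G q w → IsPivotal x → 0 < w x
  pivotal-weight-positive {w = w} rep (U , x∉U , U-loses , U+x-wins) =
    +-cancelʳ-< (weightℕ w U) 0 _
      (subst (weightℕ w U <_) (weight-∪⁅⁆ w x∉U) (losing<winning rep U+x-wins U-loses))

  pivotalWeight : Fin n → ℕ
  pivotalWeight x with pivotal? x
  ... | yes _ = 1
  ... | no _  = 0

  pivotalWeight-pivotal : IsPivotal x → pivotalWeight x ≡ 1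
  pivotalWeight-pivotal {x = x} pivotal with pivotal? x
  ... | yes _       = refl
  ... | no ¬pivotal = contradiction pivotal ¬pivotal

  pivotalWeight-null : ¬ IsPivotal x → pivotalWeight x ≡ 0
  pivotalWeight-null {x = x} ¬pivotal with pivotal? x
  ... | yes pivotal = contradiction pivotal ¬pivotal
  ... | no _        = refl

  pivotalWeight-minimum : ∀ {q : ℤ} {w : Fin n → ℕ} → IsIntRep G q w → ∀ i → pivotalWeight i ≤ w i
  pivotalWeight-minimum rep i with pivotal? i
  ... | yes pivotal = pivotal-weight-positive rep pivotal
  ... | no _        = z≤n

module PivotalCount {n} (G : SimpleGame n)
  (pivotals-≽ : ∀ {x y} → IsPivotal G x → IsPivotal G y → x ≽[ G ] y) where

  w : Fin n → ℕ
  w = pivotalWeight G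

  weight : Subset n → ℕ
  weight = weightℕ w

  more-pivotals : weight U < weight V → ∃ λ y → y ∈ V × y ∉ U × IsPivotal G y
  more-pivotals {U = U} {V = V} lighter
    with any? (λ y → y ∈? V ×-dec (¬? (y ∈? U) ×-dec pivotal? G y))
  ... | yes found = found
  ... | no none = contradiction
    (weight-≤ w (λ y∈V y∉U → pivotalWeight-null G (λ pivotal → none (_ , y∈V , y∉U , pivotal))))
    (<⇒≱ lighter)

  weight-remove-null : ¬ IsPivotal G x → x ∈ U → weight (U - x) ≡ weight U
  weight-remove-null {x = x} {U = U} ¬pivotal x∈U =
    trans (cong (_+ weight (U - x)) (sym (pivotalWeight-null G ¬pivotal))) (weight-remove w x∈U)

  weight-remove-pivotal : IsPivotal G x → x ∈ U → suc (weight (U - x)) ≡ weight U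
  weight-remove-pivotal {x = x} {U = U} pivotal x∈U =
    trans (cong (_+ weight (U - x)) (sym (pivotalWeight-pivotal G pivotal))) (weight-remove w x∈U)

  -- A member x of U outside V is either null and dropped, or pivotal and
  -- exchanged for a pivotal member of V outside U.
  replace-outsider : x ∈ U → x ∉ V → χ G U ≡ true → weight U ≤ weight V →
                     ∃ λ U′ → U′ ⊆ (U - x) ∪ V × χ G U′ ≡ true × weight U′ ≤ weight V
  replace-outsider {x = x} {U = U} {V = V} x∈U x∉V U-wins U≤V with pivotal? G x
  ... | no ¬pivotal = U - x , p⊆p∪q V , U-x-wins , U-x≤V
    where
    U-x-wins : χ G (U - x) ≡ true
    U-x-wins = trans (¬pivotal⇒null G ¬pivotal (U - x))
                     (trans (cong (χ G) (-∪⁅⁆-cancel x∈U)) U-wins)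
    U-x≤V : weight (U - x) ≤ weight V
    U-x≤V = ≤-trans (≤-reflexive (weight-remove-null ¬pivotal x∈U)) U≤V
  ... | yes x-pivotal
    with more-pivotals (<-≤-trans (≤-reflexive (weight-remove-pivotal x-pivotal x∈U)) U≤V)
  ... | y , y∈V , y∉U-x , y-pivotal = (U - x) ∪ ⁅ y ⁆ , exchange⊆ , exchange-wins , exchange≤V
    where
    exchange⊆ : (U - x) ∪ ⁅ y ⁆ ⊆ (U - x) ∪ V
    exchange⊆ z∈ with x∈p∪q⁻ (U - x) ⁅ y ⁆ z∈
    ... | inj₁ z∈U-x = p⊆p∪q V z∈U-x
    ... | inj₂ z∈y rewrite x∈⁅y⁆⇒x≡y y z∈y = q⊆p∪q (U - x) V y∈V
    exchange-wins : χ G ((U - x) ∪ ⁅ y ⁆) ≡ true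
    exchange-wins = pivotals-≽ y-pivotal x-pivotal (U - x) y∉U-x x∉p-x
      (trans (cong (χ G) (-∪⁅⁆-cancel x∈U)) U-wins)
    exchange≤V : weight ((U - x) ∪ ⁅ y ⁆) ≤ weight V
    exchange≤V = ≤-trans (≤-reflexive (begin
      weight ((U - x) ∪ ⁅ y ⁆)  ≡⟨ weight-∪⁅⁆ w y∉U-x ⟩
      w y + weight (U - x)      ≡⟨ cong (_+ weight (U - x)) (pivotalWeight-pivotal G y-pivotal) ⟩
      suc (weight (U - x))      ≡⟨ weight-remove-pivotal x-pivotal x∈U ⟩
      weight U                  ∎)) U≤V
      where open ≡-Reasoning

  winning-upward : χ G U ≡ true → weight U ≤ weight V → χ G V ≡ true
  winning-upward {U = U} {V = V} = go (suc ∣ U ─ V ∣) ≤-refl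
    where
    go : ∀ d {U} → ∣ U ─ V ∣ < d → χ G U ≡ true → weight U ≤ weight V → χ G V ≡ true
    go (suc d) {U} bound U-wins U≤V with any? (λ x → x ∈? U ×-dec ¬? (x ∈? V))
    ... | no none = monotone G U V U⊆V U-wins
      where
      U⊆V : U ⊆ V
      U⊆V {x} x∈U with x ∈? V
      ... | yes x∈V = x∈V
      ... | no x∉V  = contradiction (x , x∈U , x∉V) none
    ... | yes (x , x∈U , x∉V) with replace-outsider x∈U x∉V U-wins U≤V
    ... | U′ , U′⊆ , U′-wins , U′≤V =
      go d (<-≤-trans (∣─∣-decreasing U′⊆ x∈U x∉V) (s≤s⁻¹ bound)) U′-wins U′≤V

  minimum-winning : ∃ λ M → χ G M ≡ true × (∀ {U} → χ G U ≡ true → weight M ≤ weight U)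
  minimum-winning = argmin-subset (λ U → χ G U ≟ᵇ true) weight (grand G)

  M : Subset n
  M = proj₁ minimum-winning

  M-wins : χ G M ≡ true
  M-wins = proj₁ (proj₂ minimum-winning)

  M-minimum : χ G U ≡ true → weight M ≤ weight U
  M-minimum = proj₂ (proj₂ minimum-winning)

  quota : ℤ
  quota = + weight M

  isIntRep : IsIntRep G quota w
  isIntRep = IsIntRep-threshold G (λ _ → M-minimum) lighter
    where
    lighter : ∀ U → χ G U ≡ false → weight U < weight M
    lighter U U-loses with weight M ≤? weight U
    ... | yes M≤U = contradiction (trans (sym (winning-upward M-wins M≤U)) U-loses) λ ()
    ... | no M≰U  = ≰⇒> M≰U

  isMinIntRep : IsMinIntRep G quota w
  isMinIntRep = isIntRep , λ _ _ → pivotalWeight-minimum G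

  M-minus-pivotal : ∃ λ V → χ G V ≡ false × weight M ≡ suc (weight V)
  M-minus-pivotal
    with more-pivotals {U = ⊥} (losing<winning G isIntRep M-wins (empty G))
  ... | x , x∈M , _ , x-pivotal = M - x , M-x-loses , M≡M-x+1
    where
    M≡M-x+1 : weight M ≡ suc (weight (M - x))
    M≡M-x+1 = sym (weight-remove-pivotal x-pivotal x∈M)
    M-x-loses : χ G (M - x) ≡ false
    M-x-loses = ¬-not λ M-x-wins → <⇒≱ (≤-reflexive (sym M≡M-x+1)) (M-minimum M-x-wins)

  isMinIntRep-unique : ∀ q′ w′ → IsMinIntRep G q′ w′ → (q′ ≡ quota) × (∀ i → w′ i ≡ w i)
  isMinIntRep-unique q′ w′ (rep′ , minimal′) = q′≡quota , w′≗w
    where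
    w′≗w : ∀ i → w′ i ≡ w i
    w′≗w i = ≤-antisym (minimal′ quota w isIntRep i) (proj₂ isMinIntRep q′ w′ rep′ i)
    q′≡quota : q′ ≡ quota
    q′≡quota with M-minus-pivotal
    ... | V , V-loses , M≡V+1 = quota-pinned G (IsIntRep-cong G w′≗w rep′) M-wins V-loses M≡V+1

pivotals-equivalent : ∀ (G : SimpleGame n) (a b : Fin n) →
                      (∀ c → (c ∼[ G ] a) ⊎ (c ∼[ G ] b)) → (∀ c → c ∼[ G ] b → IsNull G c) →
                      ∀ {x y} → IsPivotal G x → IsPivotal G y → x ≽[ G ] y
pivotals-equivalent G a b classes nulls x-pivotal y-pivotal =
  ≽-trans G (proj₁ (∼a x-pivotal)) (proj₂ (∼a y-pivotal))
  where
  ∼a : ∀ {c} → IsPivotal G c → c ∼[ G ] a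
  ∼a {c} c-pivotal with classes c
  ... | inj₁ c∼a = c∼a
  ... | inj₂ c∼b = contradiction c-pivotal (null⇒¬pivotal G (nulls c c∼b))

mainTheorem12 : ∀ (n : ℕ) (G : SimpleGame n) →
    IsWeighted G → TwoTypesOneNull G →
    Σ ℤ (λ q → Σ (Fin n → ℕ) (λ w →
    IsMinIntRep G q w ×
    (∀ q' w' → IsMinIntRep G q' w' → (q' ≡ q) × (∀ i → w' i ≡ w i))))
mainTheorem12 n G _ (a , b , _ , classes , nulls) = quota , w , isMinIntRep , isMinIntRep-unique
  where open PivotalCount G (pivotals-equivalent G a b classes nulls)
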